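{- Let $n\geq 4$ and let $H_n$ be the graph with vertex set $\{v_{i,j} : i\in\{0,\dots,n-1\},\ j\in\mathbb Z_3\}$ in which $v_{i,j}v_{i,j'}$ is an edge for all $i$ and $j\neq j'$, $v_{i,j}v_{i+1,j}$ is an edge for $0\leq i\leq n-2$, and $v_{0,j}v_{n-1,-j}$ is an edge for all $j\in\mathbb Z_3$ (no other edges). Let $C_i=\{v_{i,j}: j\in\mathbb Z_3\}$ and $R_j=\{v_{i,j}:0\le i\le n-1\}$. Let $W\subseteq V(H_n)$ be such that none of the following holds: (a) $|W\cap C_i|\geq 2$ for some $i\in\{0,\dots,n-1\}$; (b) $W$ contains at least $n-1$ vertices of $R_0$ and $n$ is odd; (c) the subgraph of $H_n$ induced on $W\setminus R_0$ contains a path with at least $n$ vertices and $n$ is even. Then $H_n^{(W)}$ is $4$-colourable.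
   Context: Graphs are simple. Replicating a vertex $w$ means adding a new vertex $w'$ adjacent to $w$ and all neighbours of $w$; $H_n^{(W)}$ denotes the graph obtained by replicating every vertex of $W$ in sequence (the result does not depend on the order). -}

module Defs where

open import Level using (0ℓ)
open import Data.Nat using (ℕ; zero; suc; _≤_; _∸_; _%_)
open import Data.Fin using (Fin; toℕ) renaming (zero to fz; suc to fs)
open import Data.Product using (_×_; _,_; proj₁; proj₂; Σ; ∃)
open import Data.Sum using (_⊎_)
open import Data.Maybe using (Maybe; just; nothing)
open import Data.Empty using (⊥)
open import Data.List using (List; []; _∷_; map; length; filter)
open import Data.List.Membership.Propositional using (_∈_)
open import Data.List.Relation.Unary.Unique.Propositional using (Unique)
open import Relation.Binary.PropositionalEquality using (_≡_; _≢_)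
open import Relation.Nullary using (¬_)
import Data.Fin.Properties as FinP

-- A graph: a vertex type with an (intended symmetric, irreflexive) adjacency relation.
record Graph : Set₁ where
  field
    V   : Set
    adj : V → V → Set
open Graph public

-- Replicating a vertex w: add a new vertex w' (here: nothing) adjacent to w
-- and to all neighbours of w; old vertices v become (just v).
replicate : (G : Graph) → V G → Graph
replicate G w = record { V = Maybe (V G) ; adj = a }
  where
  a : Maybe (V G) → Maybe (V G) → Set
  a (just u) (just v) = adj G u v
  a nothing  (just v) = (v ≡ w) ⊎ adj G w v
  a (just u) nothing  = (u ≡ w) ⊎ adj G w u
  a nothing  nothing  = ⊥

-- Replicating the vertices of a list in sequence.
-- 'e' tracks where the original vertices sit in the current graph.
replicateAll' : {A : Set} (G : Graph) → (A → V G) → List A → Graph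
replicateAll' G e []       = G
replicateAll' G e (w ∷ ws) = replicateAll' (replicate G (e w)) (λ a → just (e a)) ws

replicateAll : (G : Graph) → List (V G) → Graph
replicateAll G ws = replicateAll' G (λ v → v) ws

Colourable : ℕ → Graph → Set
Colourable k G = Σ (V G → Fin k) λ c → ∀ u v → adj G u v → c u ≢ c v

neg3 : Fin 3 → Fin 3
neg3 fz = fz
neg3 (fs fz) = fs (fs fz)
neg3 (fs (fs fz)) = fs fz

Vtx : ℕ → Set
Vtx n = Fin n × Fin 3

-- Directed version of the edge set of H_n (each edge listed at least once).
HEdge : (n : ℕ) → Vtx n → Vtx n → Set
HEdge n (i , j) (i' , j') =
    (i ≡ i' × j ≢ j')
  ⊎ (toℕ i' ≡ suc (toℕ i) × j ≡ j')
  ⊎ (toℕ i ≡ 0 × toℕ i' ≡ n ∸ 1 × j' ≡ neg3 j)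

H : ℕ → Graph
H n = record { V = Vtx n ; adj = λ u v → HEdge n u v ⊎ HEdge n v u }

col : ∀ {n} → Vtx n → Fin n
col = proj₁

row : ∀ {n} → Vtx n → Fin 3
row = proj₂

countR0 : ∀ {n} → List (Vtx n) → ℕ
countR0 W = length (filter (λ v → row v FinP.≟ fz) W)

data Walk (G : Graph) (P : V G → Set) : List (V G) → Set where
  one  : ∀ {v} → P v → Walk G P (v ∷ [])
  cons : ∀ {u v vs} → P u → adj G u v → Walk G P (v ∷ vs) → Walk G P (u ∷ v ∷ vs)

PathIn : (G : Graph) → (V G → Set) → List (V G) → Set
PathIn G P vs = Walk G P vs × Unique vs

module Submission where

-- Fill the columns of H_n without a vertex of W with a dummy letter, so that W becomes a word
-- y ∈ Z₃ⁿ recording the row of W in each column.  Column i is coloured by a bijection σᵢ from four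
-- positions to the four colours: the vertex in row yᵢ, its replica, and the vertices in rows yᵢ + 1
-- and yᵢ + 2.  Consecutive columns are compatible as soon as σᵢ⁻¹σᵢ₊₁ is a move allowed by the step
-- yᵢ₊₁ - yᵢ: for an unchanged letter one of the two double transpositions other than
-- z = (vertex replica)(row+1 row+2), for a changed letter the identity or one of two 3-cycles lying
-- in different cosets of the Klein group V₄ ⊴ A₄.  The twisted edges between the last and the first
-- column ask the product of the n moves along the closed walk y₀, …, y_{n-1}, -y₀ to be z.
-- If the number s of unchanged steps is even and positive, double transpositions alone give z, and
-- if s = 0 the first four turns do.  If s is odd, two turns from inverse cosets sandwich the
-- unchanged steps into an element of V₄ that is z for suitable parities of the three stretches of
-- unchanged steps; among the first three turns such a pair always exists.  With at most two turns
-- the remaining failures are exactly the words with n - 1 zeros (n odd) and c…c(-c)…(-c) with c ≠ 0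
-- (n even), which conditions (b) and (c) exclude.

open import Defs hiding (replicate)
open import Data.Bool using (Bool; true; false; not; if_then_else_; _xor_)
open import Data.Bool.Properties using (not-distribˡ-xor; not-involutive)
open import Data.Empty using (⊥-elim)
open import Data.Fin using (Fin; zero; suc; toℕ; fromℕ; fromℕ<; punchIn)
open import Data.Fin.Properties
  using (all?; any?; _≟_; toℕ-injective; toℕ-fromℕ; toℕ-fromℕ<; punchIn-injective; punchInᵢ≢i;
         injective⇒≤)
open import Data.List using (List; []; _∷_; _++_; length; replicate; tabulate; filter; applyUpTo; lookup)
open import Data.List.Membership.Propositional using (_∈_)
open import Data.List.Membership.Propositional.Properties using (∈-filter⁺; ∈-applyUpTo⁻)
import Data.List.Membership.DecPropositional as DecMembership
open import Data.List.Properties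
  using (++-assoc; ∷-injective; ∷-injectiveˡ; ∷-injectiveʳ; ∷ʳ-injective; length-++; length-replicate;
         length-tabulate; length-applyUpTo)
open import Data.List.Relation.Unary.All using (All; []; _∷_)
import Data.List.Relation.Unary.All as All
open import Data.List.Relation.Unary.All.Properties using (++⁺)
open import Data.List.Relation.Unary.Any using (here; there; index)
open import Data.List.Relation.Unary.Any.Properties using (lookup-index)
open import Data.List.Relation.Unary.Linked using (Linked; [-]; _∷_)
import Data.List.Relation.Unary.Linked.Properties as Linked
open import Data.List.Relation.Unary.Unique.Propositional using (Unique; []; _∷_)
import Data.List.Relation.Unary.Unique.Propositional.Properties as Unique
open import Data.Maybe using (just; nothing)
open import Data.Maybe.Properties using (just-injective)
open import Data.Nat using (ℕ; zero; suc; pred; _+_; _∸_; _≤_; _<_; _%_; s≤s; z≤n; _<?_)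
import Data.Nat.Properties as ℕ
open import Data.Product using (Σ; _×_; _,_; proj₁; proj₂)
import Data.Product.Properties as Product
open import Data.Sum using (_⊎_; inj₁; inj₂)
open import Function using (_∘_; id)
open import Function.Definitions using (Injective)
open import Relation.Binary.Definitions using (tri<; tri≈; tri>)
open import Relation.Binary.PropositionalEquality
open import Relation.Nullary using (¬_; Dec; yes; no)
open import Relation.Nullary.Decidable using (True; toWitness; from-yes; ¬?; _→-dec_)

pattern r₀ = zero
pattern r₁ = suc zero
pattern r₂ = suc (suc zero)

infixl 6 _⊕_
_⊕_ : Fin 3 → Fin 3 → Fin 3
r₀ ⊕ j  = j
r₁ ⊕ r₀ = r₁
r₁ ⊕ r₁ = r₂
r₁ ⊕ r₂ = r₀
r₂ ⊕ r₀ = r₂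
r₂ ⊕ r₁ = r₀
r₂ ⊕ r₂ = r₁

-- The positions of a column whose letter is y: the vertex in row y, its replica (present only if
-- that vertex is in W) and the vertices in rows y + 1 and y + 2.
Pos : Set
Pos = Fin 4

pattern base  = zero
pattern twin  = suc zero
pattern above = suc (suc zero)
pattern below = suc (suc (suc zero))

offset : Pos → Fin 3
offset base  = r₀
offset twin  = r₀
offset above = r₁
offset below = r₂

rowAt : Fin 3 → Pos → Fin 3
rowAt y p = y ⊕ offset p

toSlot : Fin 3 → Pos
toSlot r₀ = base
toSlot r₁ = above
toSlot r₂ = below

slot : Fin 3 → Fin 3 → Pos
slot y r = toSlot (neg3 y ⊕ r)

rowAt-slot : ∀ y r → rowAt y (slot y r) ≡ r
rowAt-slot = from-yes (all? λ y → all? λ r → rowAt y (slot y r) ≟ r)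

slot≢twin : ∀ y r → slot y r ≢ twin
slot≢twin = from-yes (all? λ y → all? λ r → ¬? (slot y r ≟ twin))

rowAt-twin : ∀ y → rowAt y twin ≡ y
rowAt-twin = from-yes (all? λ y → rowAt y twin ≟ y)

-- Steps and moves

data Dir : Set where
  up down : Dir

data Step : Set where
  same : Step
  turn : Dir → Step

shift : Step → Fin 3
shift same        = r₀
shift (turn up)   = r₁
shift (turn down) = r₂

toStep : Fin 3 → Step
toStep r₀ = same
toStep r₁ = turn up
toStep r₂ = turn down

stepOf : Fin 3 → Fin 3 → Step
stepOf y y′ = toStep (neg3 y ⊕ y′)

_≟ᵈ_ : (X Y : Dir) → Dec (X ≡ Y)
up   ≟ᵈ up   = yes refl
down ≟ᵈ down = yes refl
up   ≟ᵈ down = no λ ()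
down ≟ᵈ up   = no λ ()

_≟ₛ_ : (s t : Step) → Dec (s ≡ t)
same   ≟ₛ same   = yes refl
same   ≟ₛ turn _ = no λ ()
turn _ ≟ₛ same   = no λ ()
turn X ≟ₛ turn Y with X ≟ᵈ Y
... | yes refl = yes refl
... | no X≢Y   = no λ { refl → X≢Y refl }

turn≢same : ∀ {X} → turn X ≢ same
turn≢same ()

turn-injective : ∀ {X Y} → turn X ≡ turn Y → X ≡ Y
turn-injective refl = refl

alternating : ∀ {X Y Z : Dir} → X ≢ Y → Y ≢ Z → X ≡ Z
alternating {up}   {up}          X≢Y _   = ⊥-elim (X≢Y refl)
alternating {down} {down}        X≢Y _   = ⊥-elim (X≢Y refl)
alternating {_}    {up}   {up}   _   Y≢Z = ⊥-elim (Y≢Z refl)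
alternating {_}    {down} {down} _   Y≢Z = ⊥-elim (Y≢Z refl)
alternating {up}   {down} {up}   _   _   = refl
alternating {down} {up}   {down} _   _   = refl

-- σᵢ₊₁ = σᵢ ∘ ⟦ m ⟧: a move tells where the colour at each position of the next column sits in the
-- current one.
data Move : Step → Set where
  flipA flipB      : Move same
  stay turn₁ turn₂ : ∀ {d} → Move (turn d)

⟦_⟧ : ∀ {t} → Move t → Pos → Pos
⟦ flipA ⟧        = λ { base → above ; twin → below ; above → base ; below → twin }
⟦ flipB ⟧        = λ { base → below ; twin → above ; above → twin ; below → base }
⟦ stay ⟧         = id
⟦ turn₁ {up} ⟧   = λ { base → below ; twin → twin  ; above → base  ; below → above }
⟦ turn₂ {up} ⟧   = λ { base → base  ; twin → below ; above → twin  ; below → above }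
⟦ turn₁ {down} ⟧ = λ { base → base  ; twin → above ; above → below ; below → twin }
⟦ turn₂ {down} ⟧ = λ { base → above ; twin → twin  ; above → below ; below → base }

-- Reading the first column upside down (rows negated) is the same as reading it through swap.
swap : Pos → Pos
swap = λ { base → twin ; twin → base ; above → below ; below → above }

swap-involutive : ∀ p → swap (swap p) ≡ p
swap-involutive = from-yes (all? λ p → swap (swap p) ≟ p)

rowAt-swap : ∀ y p → rowAt (neg3 y) (swap p) ≡ neg3 (rowAt y p)
rowAt-swap = from-yes (all? λ y → all? λ p → rowAt (neg3 y) (swap p) ≟ neg3 (rowAt y p))

infix 4 _≗?_
_≗?_ : (f g : Pos → Pos) → Dec (f ≗ g)
f ≗? g = all? λ p → f p ≟ g p

Valid : Step → (Pos → Pos) → Set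
Valid t f = ∀ q → offset (f q) ≢ shift t ⊕ offset q

valid? : ∀ t f → Dec (Valid t f)
valid? t f = all? λ q → ¬? (offset (f q) ≟ shift t ⊕ offset q)

injective? : (f : Pos → Pos) → Dec (∀ p q → f p ≡ f q → p ≡ q)
injective? f = all? λ p → all? λ q → (f p ≟ f q) →-dec (p ≟ q)

move-valid : ∀ {t} (m : Move t) → Valid t ⟦ m ⟧
move-valid flipA          = from-yes (valid? same ⟦ flipA ⟧)
move-valid flipB          = from-yes (valid? same ⟦ flipB ⟧)
move-valid (stay {up})    = from-yes (valid? (turn up) id)
move-valid (stay {down})  = from-yes (valid? (turn down) id)
move-valid (turn₁ {up})   = from-yes (valid? (turn up) ⟦ turn₁ {up} ⟧)
move-valid (turn₁ {down}) = from-yes (valid? (turn down) ⟦ turn₁ {down} ⟧)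
move-valid (turn₂ {up})   = from-yes (valid? (turn up) ⟦ turn₂ {up} ⟧)
move-valid (turn₂ {down}) = from-yes (valid? (turn down) ⟦ turn₂ {down} ⟧)

move-injective : ∀ {t} (m : Move t) → Injective _≡_ _≡_ ⟦ m ⟧
move-injective m {p} {q} = injective m p q
  where
  injective : ∀ {t} (m : Move t) → ∀ p q → ⟦ m ⟧ p ≡ ⟦ m ⟧ q → p ≡ q
  injective flipA          = from-yes (injective? ⟦ flipA ⟧)
  injective flipB          = from-yes (injective? ⟦ flipB ⟧)
  injective (stay {up})    = from-yes (injective? id)
  injective (stay {down})  = from-yes (injective? id)
  injective (turn₁ {up})   = from-yes (injective? ⟦ turn₁ {up} ⟧)
  injective (turn₁ {down}) = from-yes (injective? ⟦ turn₁ {down} ⟧)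
  injective (turn₂ {up})   = from-yes (injective? ⟦ turn₂ {up} ⟧)
  injective (turn₂ {down}) = from-yes (injective? ⟦ turn₂ {down} ⟧)

-- Realising a permutation by a sequence of moves

product : ∀ {ts} → All Move ts → Pos → Pos
product []       = id
product (m ∷ ms) = ⟦ m ⟧ ∘ product ms

Realises : List Step → (Pos → Pos) → Set
Realises ts f = Σ (All Move ts) λ ms → product ms ≗ f

product-++ : ∀ {ts us} (ms : All Move ts) (ns : All Move us) → product (++⁺ ms ns) ≗ product ms ∘ product ns
product-++ []       ns p = refl
product-++ (m ∷ ms) ns p = cong ⟦ m ⟧ (product-++ ms ns p)

infixr 5 _⊗_
_⊗_ : ∀ {ts us f g} → Realises ts f → Realises us g → Realises (ts ++ us) (f ∘ g)
_⊗_ {f = f} (ms , ms≗f) (ns , ns≗g) =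
  ++⁺ ms ns , λ p → trans (product-++ ms ns p) (trans (ms≗f _) (cong f (ns≗g p)))

single : ∀ {t} (m : Move t) → Realises (t ∷ []) ⟦ m ⟧
single m = m ∷ [] , λ _ → refl

realises-≗ : ∀ {ts f g} → f ≗ g → Realises ts f → Realises ts g
realises-≗ f≗g (ms , ms≗f) = ms , λ p → trans (ms≗f p) (f≗g p)

certified : ∀ {ts f} → Realises ts f → {True (f ≗? swap)} → Realises ts swap
certified r {f≗swap} = realises-≗ (toWitness f≗swap) r

certify : ∀ {ts} (ms : All Move ts) → {True (product ms ≗? swap)} → Realises ts swap
certify ms {ok} = certified (ms , λ _ → refl) {ok}

isOdd : ℕ → Bool
isOdd zero    = false
isOdd (suc n) = not (isOdd n)

isOdd-+ : ∀ m n → isOdd (m + n) ≡ isOdd m xor isOdd n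
isOdd-+ zero    n = refl
isOdd-+ (suc m) n = trans (cong not (isOdd-+ m n)) (not-distribˡ-xor (isOdd m) (isOdd n))

isOdd-pred : ∀ k {b} → isOdd (suc k) ≡ not b → isOdd k ≡ b
isOdd-pred k {b} eq with isOdd k | b
... | true  | true  = refl
... | false | false = refl
isOdd-pred k () | true  | false
isOdd-pred k () | false | true

odd-positive : ∀ n → isOdd n ≡ true → 1 ≤ n
odd-positive (suc n) _ = s≤s z≤n

zero-or-positive : ∀ n → n ≡ 0 ⊎ 1 ≤ n
zero-or-positive zero    = inj₁ refl
zero-or-positive (suc n) = inj₂ (s≤s z≤n)

countSame : List Step → ℕ
countSame []            = 0
countSame (same ∷ ts)   = suc (countSame ts)
countSame (turn _ ∷ ts) = countSame ts

countSame-++ : ∀ ts us → countSame (ts ++ us) ≡ countSame ts + countSame us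
countSame-++ []            us = refl
countSame-++ (same ∷ ts)   us = cong suc (countSame-++ ts us)
countSame-++ (turn _ ∷ ts) us = countSame-++ ts us

flips : ℕ → Pos → Pos
flips zero    = id
flips (suc k) = ⟦ flipA ⟧ ∘ flips k

flips-if : ∀ k {b} → isOdd k ≡ b → flips k ≗ (if b then ⟦ flipA ⟧ else id)
flips-if zero    refl p = refl
flips-if (suc k) refl p with isOdd k | flips-if k refl p
... | true  | eq = trans (cong ⟦ flipA ⟧ eq) (from-yes (⟦ flipA ⟧ ∘ ⟦ flipA ⟧ ≗? id) p)
... | false | eq = cong ⟦ flipA ⟧ eq

flat : ∀ ts → Realises ts (flips (countSame ts))
flat []            = [] , λ _ → refl
flat (same ∷ ts)   = single flipA ⊗ flat ts
flat (turn _ ∷ ts) = single stay ⊗ flat ts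

flatB : ∀ ts {k} → countSame ts ≡ suc k → Realises ts (⟦ flipB ⟧ ∘ flips k)
flatB (same ∷ ts)   refl = single flipB ⊗ flat ts
flatB (turn _ ∷ ts) eq   = single stay ⊗ flatB ts eq

segment-id : ∀ ts → isOdd (countSame ts) ≡ false → Realises ts id
segment-id ts even = realises-≗ (flips-if (countSame ts) even) (flat ts)

segment-flipA : ∀ ts → isOdd (countSame ts) ≡ true → Realises ts ⟦ flipA ⟧
segment-flipA ts odd = realises-≗ (flips-if (countSame ts) odd) (flat ts)

segment-flipB : ∀ ts → isOdd (countSame ts) ≡ true → Realises ts ⟦ flipB ⟧
segment-flipB ts odd with countSame ts in count
... | suc k = realises-≗ (λ p → cong ⟦ flipB ⟧ (flips-if k (isOdd-pred k odd) p)) (flatB ts count)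

segment-swap : ∀ ts → isOdd (countSame ts) ≡ false → 1 ≤ countSame ts → Realises ts swap
segment-swap ts even _ with countSame ts in count
... | suc k = realises-≗ (λ p → trans (cong ⟦ flipB ⟧ (flips-if k (isOdd-pred k even) p))
                                        (from-yes (⟦ flipB ⟧ ∘ ⟦ flipA ⟧ ≗? swap) p))
                        (flatB ts count)

-- Which step sequences realise swap

data Fit (X Y : Dir) (inner outer : ℕ) : Set where
  parallel : X ≡ Y → 1 ≤ outer → Fit X Y inner outer
  crossed  : X ≢ Y → 1 ≤ inner → Fit X Y inner outer

-- turn₁ and turn₂ lie in inverse cosets of V₄, so each candidate below lies in V₄; which element it
-- is depends only on the parities of the three stretches of same steps.
pair-crossed : ∀ A B C {X Y} a b c → isOdd (countSame A) ≡ a → isOdd (countSame B) ≡ b →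
               isOdd (countSame C) ≡ c → a xor b xor c ≡ true → X ≢ Y → 1 ≤ countSame B →
               Realises (A ++ turn X ∷ B ++ turn Y ∷ C) swap
pair-crossed A B C {up}   {up}   _ _ _ _ _ _ _ X≢Y _ = ⊥-elim (X≢Y refl)
pair-crossed A B C {down} {down} _ _ _ _ _ _ _ X≢Y _ = ⊥-elim (X≢Y refl)
pair-crossed A B C {up}   {down} true true true eA eB eC _ _ _ =
  certified (segment-flipA A eA ⊗ single turn₁ ⊗ segment-flipB B eB ⊗ single turn₂ ⊗ segment-flipA C eC)
pair-crossed A B C {down} {up}   true true true eA eB eC _ _ _ =
  certified (segment-flipA A eA ⊗ single turn₁ ⊗ segment-flipB B eB ⊗ single turn₂ ⊗ segment-flipA C eC)
pair-crossed A B C {up}   {down} false true false eA eB eC _ _ _ =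
  certified (segment-id A eA ⊗ single turn₁ ⊗ segment-flipB B eB ⊗ single turn₂ ⊗ segment-id C eC)
pair-crossed A B C {down} {up}   false true false eA eB eC _ _ _ =
  certified (segment-id A eA ⊗ single turn₁ ⊗ segment-flipB B eB ⊗ single turn₂ ⊗ segment-id C eC)
pair-crossed A B C {up}   {down} true false false eA eB eC _ _ inner =
  certified (segment-flipA A eA ⊗ single turn₂ ⊗ segment-swap B eB inner ⊗ single turn₁ ⊗ segment-id C eC)
pair-crossed A B C {down} {up}   true false false eA eB eC _ _ inner =
  certified (segment-flipA A eA ⊗ single turn₂ ⊗ segment-swap B eB inner ⊗ single turn₁ ⊗ segment-id C eC)
pair-crossed A B C {up}   {down} false false true eA eB eC _ _ inner =
  certified (segment-id A eA ⊗ single turn₂ ⊗ segment-swap B eB inner ⊗ single turn₁ ⊗ segment-flipA C eC)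
pair-crossed A B C {down} {up}   false false true eA eB eC _ _ inner =
  certified (segment-id A eA ⊗ single turn₂ ⊗ segment-swap B eB inner ⊗ single turn₁ ⊗ segment-flipA C eC)

pair-parallel : ∀ A B C X a b c → isOdd (countSame A) ≡ a → isOdd (countSame B) ≡ b →
                isOdd (countSame C) ≡ c → a xor b xor c ≡ true → 1 ≤ countSame A + countSame C →
                Realises (A ++ turn X ∷ B ++ turn X ∷ C) swap
pair-parallel A B C up   true false false eA eB eC _ _ =
  certified (segment-flipA A eA ⊗ single turn₁ ⊗ segment-id B eB ⊗ single turn₂ ⊗ segment-id C eC)
pair-parallel A B C down true false false eA eB eC _ _ =
  certified (segment-flipA A eA ⊗ single turn₁ ⊗ segment-id B eB ⊗ single turn₂ ⊗ segment-id C eC)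
pair-parallel A B C up   false false true eA eB eC _ _ =
  certified (segment-id A eA ⊗ single turn₁ ⊗ segment-id B eB ⊗ single turn₂ ⊗ segment-flipA C eC)
pair-parallel A B C down false false true eA eB eC _ _ =
  certified (segment-id A eA ⊗ single turn₁ ⊗ segment-id B eB ⊗ single turn₂ ⊗ segment-flipA C eC)
pair-parallel A B C up   true true true eA eB eC _ _ =
  certified (segment-flipA A eA ⊗ single turn₁ ⊗ segment-flipA B eB ⊗ single turn₂ ⊗ segment-flipB C eC)
pair-parallel A B C down true true true eA eB eC _ _ =
  certified (segment-flipA A eA ⊗ single turn₁ ⊗ segment-flipA B eB ⊗ single turn₂ ⊗ segment-flipB C eC)
pair-parallel A B C X false true false eA eB eC _ outer = by-A X (zero-or-positive (countSame A))
  where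
  by-A : ∀ X → countSame A ≡ 0 ⊎ 1 ≤ countSame A → Realises (A ++ turn X ∷ B ++ turn X ∷ C) swap
  by-A up (inj₁ none) =
    certified (segment-id A eA ⊗ single turn₁ ⊗ segment-flipA B eB ⊗ single turn₂ ⊗
               segment-swap C eC (subst (λ k → 1 ≤ k + _) none outer))
  by-A down (inj₁ none) =
    certified (segment-id A eA ⊗ single turn₁ ⊗ segment-flipA B eB ⊗ single turn₂ ⊗
               segment-swap C eC (subst (λ k → 1 ≤ k + _) none outer))
  by-A up (inj₂ some) =
    certified (segment-swap A eA some ⊗ single turn₁ ⊗ segment-flipA B eB ⊗ single turn₂ ⊗ segment-id C eC)
  by-A down (inj₂ some) =
    certified (segment-swap A eA some ⊗ single turn₁ ⊗ segment-flipA B eB ⊗ single turn₂ ⊗ segment-id C eC)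

odd-around : ∀ A B C {X Y} → isOdd (countSame (A ++ turn X ∷ B ++ turn Y ∷ C)) ≡ true →
             isOdd (countSame A) xor isOdd (countSame B) xor isOdd (countSame C) ≡ true
odd-around A B C odd =
  trans (sym (trans (isOdd-+ (countSame A) _) (cong (isOdd (countSame A) xor_) (isOdd-+ (countSame B) _))))
        (trans (cong isOdd (sym (trans (countSame-++ A _) (cong (countSame A +_) (countSame-++ B _))))) odd)

pair : ∀ A B C {X Y} → isOdd (countSame (A ++ turn X ∷ B ++ turn Y ∷ C)) ≡ true →
       Fit X Y (countSame B) (countSame A + countSame C) → Realises (A ++ turn X ∷ B ++ turn Y ∷ C) swap
pair A B C {X} odd (parallel refl outer) = pair-parallel A B C X _ _ _ refl refl refl (odd-around A B C odd) outer
pair A B C     odd (crossed X≢Y inner)  = pair-crossed A B C _ _ _ refl refl refl (odd-around A B C odd) X≢Y inner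

four-turns : ∀ X₁ X₂ X₃ X₄ → Realises (turn X₁ ∷ turn X₂ ∷ turn X₃ ∷ turn X₄ ∷ []) swap
four-turns up   up   up   up   = certify (turn₁ ∷ turn₂ ∷ turn₂ ∷ turn₁ ∷ [])
four-turns up   up   up   down = certify (turn₁ ∷ turn₁ ∷ turn₂ ∷ turn₂ ∷ [])
four-turns up   up   down up   = certify (stay  ∷ turn₁ ∷ turn₁ ∷ turn₁ ∷ [])
four-turns up   up   down down = certify (turn₁ ∷ turn₂ ∷ turn₂ ∷ turn₁ ∷ [])
four-turns up   down up   up   = certify (turn₁ ∷ turn₁ ∷ stay  ∷ turn₁ ∷ [])
four-turns up   down up   down = certify (stay  ∷ turn₁ ∷ turn₁ ∷ turn₁ ∷ [])
four-turns up   down down up   = certify (turn₁ ∷ stay  ∷ turn₁ ∷ turn₁ ∷ [])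
four-turns up   down down down = certify (turn₁ ∷ turn₁ ∷ turn₂ ∷ turn₂ ∷ [])
four-turns down up   up   up   = certify (turn₁ ∷ turn₁ ∷ turn₂ ∷ turn₂ ∷ [])
four-turns down up   up   down = certify (turn₁ ∷ stay  ∷ turn₁ ∷ turn₁ ∷ [])
four-turns down up   down up   = certify (stay  ∷ turn₁ ∷ turn₁ ∷ turn₁ ∷ [])
four-turns down up   down down = certify (turn₁ ∷ turn₁ ∷ stay  ∷ turn₁ ∷ [])
four-turns down down up   up   = certify (turn₁ ∷ turn₂ ∷ turn₂ ∷ turn₁ ∷ [])
four-turns down down up   down = certify (stay  ∷ turn₁ ∷ turn₁ ∷ turn₁ ∷ [])
four-turns down down down up   = certify (turn₁ ∷ turn₁ ∷ turn₂ ∷ turn₂ ∷ [])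
four-turns down down down down = certify (turn₁ ∷ turn₂ ∷ turn₂ ∷ turn₁ ∷ [])

all-turns : ∀ ts → countSame ts ≡ 0 → 4 ≤ length ts → Realises ts swap
all-turns (turn X₁ ∷ turn X₂ ∷ turn X₃ ∷ turn X₄ ∷ rest) none _ =
  four-turns X₁ X₂ X₃ X₄ ⊗ segment-id rest (cong isOdd none)
all-turns (same ∷ _)                          () _
all-turns (turn _ ∷ same ∷ _)                 () _
all-turns (turn _ ∷ turn _ ∷ same ∷ _)        () _
all-turns (turn _ ∷ turn _ ∷ turn _ ∷ same ∷ _) () _
all-turns []                                  _ ()
all-turns (turn _ ∷ [])                       _ (s≤s ())
all-turns (turn _ ∷ turn _ ∷ [])              _ (s≤s (s≤s ()))
all-turns (turn _ ∷ turn _ ∷ turn _ ∷ [])     _ (s≤s (s≤s (s≤s ())))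

fitting-pair : ∀ a b c r {X Y Z} → isOdd (a + (b + (c + r))) ≡ true →
               Fit X Y b (a + (c + r)) ⊎ Fit Y Z c ((a + b) + r) ⊎ Fit X Z (b + c) (a + r)
fitting-pair a b c r {X} {Y} {Z} odd with X ≟ᵈ Y
... | yes refl = parallel-first a b c r odd
  where
  parallel-first : ∀ a b c r → isOdd (a + (b + (c + r))) ≡ true →
                   Fit X X b (a + (c + r)) ⊎ Fit X Z c ((a + b) + r) ⊎ Fit X Z (b + c) (a + r)
  parallel-first (suc a) b       c       r       _ = inj₁ (parallel refl (s≤s z≤n))
  parallel-first zero    b       (suc c) r       _ = inj₁ (parallel refl (s≤s z≤n))
  parallel-first zero    b       zero    (suc r) _ = inj₁ (parallel refl (s≤s z≤n))
  parallel-first zero    (suc b) zero    zero    _ with X ≟ᵈ Z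
  ... | yes refl = inj₂ (inj₁ (parallel refl (s≤s z≤n)))
  ... | no X≢Z   = inj₂ (inj₂ (crossed X≢Z (s≤s z≤n)))
... | no X≢Y = crossed-first a b c r odd
  where
  crossed-first : ∀ a b c r → isOdd (a + (b + (c + r))) ≡ true →
                  Fit X Y b (a + (c + r)) ⊎ Fit Y Z c ((a + b) + r) ⊎ Fit X Z (b + c) (a + r)
  crossed-first a (suc b) c r _ = inj₁ (crossed X≢Y (s≤s z≤n))
  crossed-first a zero c r odd with Y ≟ᵈ Z
  crossed-first (suc a) zero c       r       _   | yes refl = inj₂ (inj₁ (parallel refl (s≤s z≤n)))
  crossed-first zero    zero c       (suc r) _   | yes refl = inj₂ (inj₁ (parallel refl (s≤s z≤n)))
  crossed-first zero    zero (suc c) zero    _   | yes refl = inj₂ (inj₂ (crossed X≢Y (s≤s z≤n)))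
  crossed-first a       zero (suc c) r       _   | no Y≢Z   = inj₂ (inj₁ (crossed Y≢Z (s≤s z≤n)))
  crossed-first a       zero zero    r       odd | no Y≢Z   =
    inj₂ (inj₂ (parallel (alternating X≢Y Y≢Z) (odd-positive (a + r) odd)))

three-turns : ∀ A B C R {X Y Z} → isOdd (countSame (A ++ turn X ∷ B ++ turn Y ∷ C ++ turn Z ∷ R)) ≡ true →
              Realises (A ++ turn X ∷ B ++ turn Y ∷ C ++ turn Z ∷ R) swap
three-turns A B C R {X} {Y} {Z} odd
  with fitting-pair (countSame A) (countSame B) (countSame C) (countSame R)
         (trans (cong isOdd (sym (trans (countSame-++ A _) (cong (λ k → countSame A + k)
                  (trans (countSame-++ B _) (cong (countSame B +_) (countSame-++ C _))))))) odd)
... | inj₁ fit =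
  pair A B (C ++ turn Z ∷ R) odd (subst (Fit X Y _) (cong (countSame A +_) (sym (countSame-++ C _))) fit)
... | inj₂ (inj₁ fit) =
  subst (λ ts → Realises ts swap) (++-assoc A (turn X ∷ B) _)
    (pair (A ++ turn X ∷ B) C R
          (subst (λ ts → isOdd (countSame ts) ≡ true) (sym (++-assoc A (turn X ∷ B) _)) odd)
          (subst (λ k → Fit Y Z _ (k + _)) (sym (countSame-++ A _)) fit))
... | inj₂ (inj₂ fit) =
  subst (λ ts → Realises (A ++ turn X ∷ ts) swap) (++-assoc B (turn Y ∷ C) _)
    (pair A (B ++ turn Y ∷ C) R
          (subst (λ ts → isOdd (countSame (A ++ turn X ∷ ts)) ≡ true) (sym (++-assoc B (turn Y ∷ C) _)) odd)
          (subst (λ k → Fit X Z k _) (sym (countSame-++ B _)) fit))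

AllSame : List Step → Set
AllSame = All (_≡ same)

countSame-all : ∀ {ts} → AllSame ts → countSame ts ≡ length ts
countSame-all []          = refl
countSame-all (refl ∷ ss) = cong suc (countSame-all ss)

all-same-empty : ∀ {ts} → AllSame ts → countSame ts ≡ 0 → ts ≡ []
all-same-empty []         _  = refl
all-same-empty (refl ∷ _) ()

countSame-sames : ∀ {A C} ts → AllSame A → AllSame C → countSame ts ≡ 0 →
                  countSame (A ++ ts ++ C) ≡ length A + length C
countSame-sames {A} {C} ts sA sC none =
  trans (countSame-++ A _)
        (cong₂ _+_ (countSame-all sA) (trans (countSame-++ ts C) (trans (cong (_+ _) none) (countSame-all sC))))

data TurnView : List Step → Set where
  no-turn    : ∀ {ts} → AllSame ts → TurnView ts
  first-turn : ∀ A X rest → AllSame A → TurnView (A ++ turn X ∷ rest)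

turnView : ∀ ts → TurnView ts
turnView []            = no-turn []
turnView (turn X ∷ ts) = first-turn [] X ts []
turnView (same ∷ ts) with turnView ts
... | no-turn sames             = no-turn (refl ∷ sames)
... | first-turn A X rest sames = first-turn (same ∷ A) X rest (refl ∷ sames)

data Obstruction : List Step → Set where
  no-turn        : ∀ {ts} → AllSame ts → isOdd (length ts) ≡ true → Obstruction ts
  one-turn       : ∀ {A C X} → AllSame A → AllSame C → isOdd (length A + length C) ≡ true →
                   Obstruction (A ++ turn X ∷ C)
  adjacent-turns : ∀ {A C X Y} → AllSame A → AllSame C → X ≢ Y → isOdd (length A + length C) ≡ true →
                   Obstruction (A ++ turn X ∷ turn Y ∷ C)
  end-turns      : ∀ {B X} → AllSame B → isOdd (length B) ≡ true → Obstruction (turn X ∷ B ++ turn X ∷ [])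

two-turns : ∀ A B C {X Y} → AllSame A → AllSame B → AllSame C →
            isOdd (countSame (A ++ turn X ∷ B ++ turn Y ∷ C)) ≡ true →
            Realises (A ++ turn X ∷ B ++ turn Y ∷ C) swap ⊎ Obstruction (A ++ turn X ∷ B ++ turn Y ∷ C)
two-turns A B C {X} {Y} sA sB sC odd with X ≟ᵈ Y
two-turns A B C sA sB sC odd | yes refl with zero-or-positive (countSame A + countSame C)
... | inj₂ outer = inj₁ (pair A B C odd (parallel refl outer))
... | inj₁ none
  with all-same-empty sA (ℕ.m+n≡0⇒m≡0 _ none) | all-same-empty sC (ℕ.m+n≡0⇒n≡0 (countSame A) none)
...   | refl | refl =
  inj₂ (end-turns sB
         (trans (cong isOdd (sym (trans (countSame-sames (turn _ ∷ []) sB [] refl) (ℕ.+-identityʳ _)))) odd))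
two-turns A B C sA sB sC odd | no X≢Y with zero-or-positive (countSame B)
... | inj₂ inner = inj₁ (pair A B C odd (crossed X≢Y inner))
... | inj₁ none with all-same-empty sB none
...   | refl =
  inj₂ (adjacent-turns sA sC X≢Y
         (trans (cong isOdd (sym (countSame-sames (turn _ ∷ turn _ ∷ []) sA sC refl))) odd))

odd-same : ∀ ts → isOdd (countSame ts) ≡ true → Realises ts swap ⊎ Obstruction ts
odd-same ts odd with turnView ts
... | no-turn sames = inj₂ (no-turn sames (trans (cong isOdd (sym (countSame-all sames))) odd))
... | first-turn A X rest sA with turnView rest
...   | no-turn sC = inj₂ (one-turn sA sC (trans (cong isOdd (sym (countSame-sames (turn X ∷ []) sA sC refl))) odd))
...   | first-turn B Y rest′ sB with turnView rest′
...     | no-turn sC         = two-turns A B rest′ sA sB sC odd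
...     | first-turn C Z R _ = inj₁ (three-turns A B C R odd)

classify : ∀ ts → 4 ≤ length ts → Realises ts swap ⊎ Obstruction ts
classify ts long with zero-or-positive (countSame ts) | isOdd (countSame ts) in parity
... | inj₁ none | _     = inj₁ (all-turns ts none long)
... | inj₂ some | false = inj₁ (segment-swap ts parity some)
... | inj₂ _    | true  = odd-same ts parity

-- From words to steps and back

stepsOf : Fin 3 → List (Fin 3) → List Step
stepsOf u []       = []
stepsOf u (v ∷ vs) = stepOf u v ∷ stepsOf v vs

cycleSteps : Fin 3 → List (Fin 3) → List Step
cycleSteps u vs = stepsOf u (vs ++ neg3 u ∷ [])

length-stepsOf : ∀ u vs → length (stepsOf u vs) ≡ length vs
length-stepsOf u []       = refl
length-stepsOf u (v ∷ vs) = cong suc (length-stepsOf v vs)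

length-cycleSteps : ∀ u vs → length (cycleSteps u vs) ≡ length (u ∷ vs)
length-cycleSteps u vs =
  trans (length-stepsOf u (vs ++ neg3 u ∷ [])) (trans (length-++ vs) (ℕ.+-comm (length vs) 1))

stepOf-same : ∀ u v → stepOf u v ≡ same → v ≡ u
stepOf-same = from-yes (all? λ u → all? λ v → (stepOf u v ≟ₛ same) →-dec (v ≟ u))

neg3-fixed : ∀ u → neg3 u ≡ u → u ≡ r₀
neg3-fixed = from-yes (all? λ u → (neg3 u ≟ u) →-dec (u ≟ r₀))

neg3-nonzero : ∀ c → c ≢ r₀ → neg3 c ≢ r₀
neg3-nonzero = from-yes (all? λ c → ¬? (c ≟ r₀) →-dec ¬? (neg3 c ≟ r₀))

turn-to-negation : ∀ {u} → stepOf u (neg3 u) ≢ same → u ≢ r₀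
turn-to-negation ¬same refl = ¬same refl

there-and-back : ∀ u v w → stepOf u v ≢ same → stepOf v w ≢ same → stepOf u v ≢ stepOf v w → w ≡ u
there-and-back = from-yes (all? λ u → all? λ v → all? λ w →
  ¬? (stepOf u v ≟ₛ same) →-dec ¬? (stepOf v w ≟ₛ same) →-dec
  ¬? (stepOf u v ≟ₛ stepOf v w) →-dec (w ≟ u))

twice-to-negation : ∀ u v → stepOf u v ≢ same → stepOf u v ≡ stepOf v (neg3 u) → v ≡ r₀
twice-to-negation = from-yes (all? λ u → all? λ v →
  ¬? (stepOf u v ≟ₛ same) →-dec (stepOf u v ≟ₛ stepOf v (neg3 u)) →-dec (v ≟ r₀))

same-steps : ∀ u vs → AllSame (stepsOf u vs) → vs ≡ replicate (length vs) u
same-steps u []       []           = refl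
same-steps u (v ∷ vs) (eq ∷ sames) with stepOf-same u v eq
... | refl = cong (u ∷_) (same-steps u vs sames)

no-steps : ∀ u vs → stepsOf u vs ≡ [] → vs ≡ []
no-steps u [] _ = refl

cons-snoc : ∀ k (u : Fin 3) → u ∷ replicate k u ≡ replicate k u ++ u ∷ []
cons-snoc zero    u = refl
cons-snoc (suc k) u = cong (u ∷_) (cons-snoc k u)

run-snoc : ∀ xs k (v : Fin 3) → xs ++ v ∷ replicate k v ≡ (xs ++ replicate k v) ++ v ∷ []
run-snoc xs k v = trans (cong (xs ++_) (cons-snoc k v)) (sym (++-assoc xs _ _))

record TurnAt (u : Fin 3) (vs : List (Fin 3)) (k : ℕ) (X : Dir) (rest : List Step) : Set where
  field
    next  : Fin 3
    after : List (Fin 3)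
    shape : vs ≡ replicate k u ++ next ∷ after
    turns : stepOf u next ≡ turn X
    steps : stepsOf next after ≡ rest

turn-at : ∀ u vs A X rest → AllSame A → stepsOf u vs ≡ A ++ turn X ∷ rest → TurnAt u vs (length A) X rest
turn-at u (v ∷ vs) []      X rest []          eq =
  record { next = v ; after = vs ; shape = refl ; turns = ∷-injectiveˡ eq ; steps = ∷-injectiveʳ eq }
turn-at u (v ∷ vs) (_ ∷ A) X rest (refl ∷ sA) eq with stepOf-same u v (∷-injectiveˡ eq)
... | refl = let open TurnAt (turn-at u vs A X rest sA (∷-injectiveʳ eq)) in
  record { next = next ; after = after ; shape = cong (u ∷_) shape ; turns = turns ; steps = steps }

data Exceptional (ws : List (Fin 3)) : Set where
  nearly-zero : ∀ a v b → ws ≡ replicate a r₀ ++ v ∷ replicate b r₀ → isOdd (length ws) ≡ true →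
                Exceptional ws
  two-blocks  : ∀ a b c → c ≢ r₀ → ws ≡ replicate (suc a) c ++ replicate b (neg3 c) →
                isOdd (length ws) ≡ false → Exceptional ws

no-turn-exceptional : ∀ u vs → AllSame (cycleSteps u vs) → isOdd (length (u ∷ vs)) ≡ true →
                      Exceptional (u ∷ vs)
no-turn-exceptional u vs sames odd
  with ∷ʳ-injective vs (replicate (length vs) u)
         (trans (same-steps u _ sames)
                (trans (cong (λ k → replicate k u) (trans (length-++ vs) (ℕ.+-comm (length vs) 1)))
                       (cons-snoc (length vs) u)))
... | vs≡ , fixed with neg3-fixed u fixed
...   | refl = nearly-zero 0 r₀ (length vs) (cong (r₀ ∷_) vs≡) odd

one-turn-exceptional : ∀ u vs A C {X} → AllSame A → AllSame C → cycleSteps u vs ≡ A ++ turn X ∷ C →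
                       isOdd (length (u ∷ vs)) ≡ false → Exceptional (u ∷ vs)
one-turn-exceptional u vs A C {X} sA sC eq even
  with turn-at u (vs ++ neg3 u ∷ []) A X C sA eq
... | record { next = v ; after = xs ; shape = shape ; turns = turns ; steps = steps }
  with ∷ʳ-injective vs (replicate (length A) u ++ replicate (length xs) v)
         (trans shape (trans (cong (λ ys → replicate (length A) u ++ v ∷ ys)
                                   (same-steps v xs (subst AllSame (sym steps) sC)))
                             (run-snoc (replicate (length A) u) (length xs) v)))
... | vs≡ , refl =
  two-blocks (length A) (length xs) u (turn-to-negation (λ e → turn≢same (trans (sym turns) e)))
             (cong (u ∷_) vs≡) even

adjacent-turns-exceptional : ∀ u vs A C {X Y} → AllSame A → AllSame C → X ≢ Y →
                             cycleSteps u vs ≡ A ++ turn X ∷ turn Y ∷ C →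
                             isOdd (length (u ∷ vs)) ≡ true → Exceptional (u ∷ vs)
adjacent-turns-exceptional u vs A C {X} {Y} sA sC X≢Y eq odd
  with turn-at u (vs ++ neg3 u ∷ []) A X (turn Y ∷ C) sA eq
... | record { next = v ; after = xs₁ ; shape = shape ; turns = turns₁ ; steps = steps₁ }
  with turn-at v xs₁ [] Y C [] steps₁
... | record { next = w ; after = xs₂ ; shape = refl ; turns = turns₂ ; steps = steps₂ }
  with there-and-back u v w (λ e → turn≢same (trans (sym turns₁) e))
                            (λ e → turn≢same (trans (sym turns₂) e))
                            (λ e → X≢Y (turn-injective (trans (sym turns₁) (trans e turns₂))))
... | refl
  with ∷ʳ-injective vs (replicate (length A) u ++ v ∷ replicate (length xs₂) u)
         (trans shape (trans (cong (λ ys → replicate (length A) u ++ v ∷ u ∷ ys)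
                                   (same-steps u xs₂ (subst AllSame (sym steps₂) sC)))
                             (trans (cong (λ ys → replicate (length A) u ++ v ∷ ys) (cons-snoc (length xs₂) u))
                                    (sym (++-assoc (replicate (length A) u) _ _)))))
... | vs≡ , fixed with neg3-fixed u fixed
...   | refl = nearly-zero (suc (length A)) v (length xs₂) (cong (r₀ ∷_) vs≡) odd

end-turns-exceptional : ∀ u vs B {X} → AllSame B → cycleSteps u vs ≡ turn X ∷ B ++ turn X ∷ [] →
                        isOdd (length (u ∷ vs)) ≡ true → Exceptional (u ∷ vs)
end-turns-exceptional u vs B {X} sB eq odd
  with turn-at u (vs ++ neg3 u ∷ []) [] X (B ++ turn X ∷ []) [] eq
... | record { next = v ; after = xs₁ ; shape = shape₁ ; turns = turns₁ ; steps = steps₁ }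
  with turn-at v xs₁ B X [] sB steps₁
... | record { next = w ; after = xs₂ ; shape = shape₂ ; turns = turns₂ ; steps = steps₂ }
  with no-steps w xs₂ steps₂
... | refl with ∷ʳ-injective vs (v ∷ replicate (length B) v) (trans shape₁ (cong (v ∷_) shape₂))
...   | vs≡ , refl
  with twice-to-negation u v (λ e → turn≢same (trans (sym turns₁) e)) (trans turns₁ (sym turns₂))
...     | refl = nearly-zero 0 u (suc (length B)) (cong (u ∷_) vs≡) odd

obstruction-exceptional : ∀ {ts} u vs → Obstruction ts → cycleSteps u vs ≡ ts → Exceptional (u ∷ vs)
obstruction-exceptional u vs obstruction eq =
  by-shape obstruction eq (cong isOdd (trans (sym (length-cycleSteps u vs)) (cong length eq)))
  where
  by-shape : ∀ {ts} → Obstruction ts → cycleSteps u vs ≡ ts →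
             isOdd (length (u ∷ vs)) ≡ isOdd (length ts) → Exceptional (u ∷ vs)
  by-shape (no-turn sames odd) eq parity =
    no-turn-exceptional u vs (subst AllSame (sym eq) sames) (trans parity odd)
  by-shape (one-turn {A} {C} sA sC odd) eq parity =
    one-turn-exceptional u vs A C sA sC eq
      (trans parity (trans (cong isOdd (trans (length-++ A) (ℕ.+-suc _ _))) (cong not odd)))
  by-shape (adjacent-turns {A} {C} sA sC X≢Y odd) eq parity =
    adjacent-turns-exceptional u vs A C sA sC X≢Y eq
      (trans parity (trans (cong isOdd (trans (length-++ A) (trans (ℕ.+-suc _ _) (cong suc (ℕ.+-suc _ _)))))
                           (cong (not ∘ not) odd)))
  by-shape (end-turns {B} sB odd) eq parity =
    end-turns-exceptional u vs B sB eq
      (trans parity (trans (cong (λ k → isOdd (suc k)) (trans (length-++ B) (ℕ.+-comm _ 1)))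
                           (cong (not ∘ not) odd)))

word-realises : ∀ u vs → 3 ≤ length vs → Realises (cycleSteps u vs) swap ⊎ Exceptional (u ∷ vs)
word-realises u vs long with classify (cycleSteps u vs) (subst (4 ≤_) (sym (length-cycleSteps u vs)) (s≤s long))
... | inj₁ realised    = inj₁ realised
... | inj₂ obstruction = inj₂ (obstruction-exceptional u vs obstruction refl)

-- Colouring H_n^(W) from compatible columns

replicateAll′-colourable :
  ∀ k (G : Graph) {A : Set} (e : A → V G) → Injective _≡_ _≡_ e →
  (c : V G → Fin k) → (∀ u v → adj G u v → c u ≢ c v) →
  (d : A → Fin k) (ws : List A) → Unique ws →
  (∀ w → w ∈ ws → ∀ v → v ≡ e w ⊎ adj G (e w) v → d w ≢ c v) →
  (∀ u w → u ∈ ws → w ∈ ws → u ≢ w → adj G (e u) (e w) → d u ≢ d w) →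
  Colourable k (replicateAll' G e ws)
replicateAll′-colourable k G e e-inj c c-proper d []       _           _       _       = c , c-proper
replicateAll′-colourable k G {A} e e-inj c c-proper d (w ∷ ws) (w∉ws ∷ unique) replica twins =
  replicateAll′-colourable k G′ (just ∘ e) (e-inj ∘ just-injective) c′ c′-proper d ws unique
                           replica′ twins′
  where
  G′ : Graph
  G′ = Defs.replicate G (e w)

  c′ : V G′ → Fin k
  c′ (just v) = c v
  c′ nothing  = d w

  c′-proper : ∀ u v → adj G′ u v → c′ u ≢ c′ v
  c′-proper (just u) (just v) u~v = c-proper u v u~v
  c′-proper nothing  (just v) w~v = replica w (here refl) v w~v
  c′-proper (just u) nothing  w~u = replica w (here refl) u w~u ∘ sym
  c′-proper nothing  nothing  ()

  w≢ : ∀ {x} → x ∈ ws → w ≢ x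
  w≢ x∈ws = All.lookup w∉ws x∈ws

  replica′ : ∀ x → x ∈ ws → ∀ v → v ≡ just (e x) ⊎ adj G′ (just (e x)) v → d x ≢ c′ v
  replica′ x x∈ws (just v) (inj₁ eq)          = replica x (there x∈ws) v (inj₁ (just-injective eq))
  replica′ x x∈ws (just v) (inj₂ x~v)         = replica x (there x∈ws) v (inj₂ x~v)
  replica′ x x∈ws nothing  (inj₂ (inj₁ eq))   = λ _ → w≢ x∈ws (sym (e-inj eq))
  replica′ x x∈ws nothing  (inj₂ (inj₂ w~x))  = twins w x (here refl) (there x∈ws) (w≢ x∈ws) w~x ∘ sym

  twins′ : ∀ u x → u ∈ ws → x ∈ ws → u ≢ x → adj G′ (just (e u)) (just (e x)) → d u ≢ d x
  twins′ u x u∈ws x∈ws = twins u x (there u∈ws) (there x∈ws)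

Compatible : Fin 3 → (Pos → Pos) → Fin 3 → (Pos → Pos) → Set
Compatible y σ y′ σ′ = ∀ p q → σ p ≡ σ′ q → rowAt y p ≢ rowAt y′ q

row-offsets : ∀ y y′ a b → y ⊕ a ≡ y′ ⊕ b → a ≡ shift (stepOf y y′) ⊕ b
row-offsets = from-yes (all? λ y → all? λ y′ → all? λ a → all? λ b →
  (y ⊕ a ≟ y′ ⊕ b) →-dec (a ≟ shift (stepOf y y′) ⊕ b))

compatible : ∀ {y y′ σ σ′} → Injective _≡_ _≡_ σ → (m : Move (stepOf y y′)) → σ′ ≗ σ ∘ ⟦ m ⟧ →
             Compatible y σ y′ σ′
compatible {y} {y′} σ-inj m σ′≗ p q same-colour same-row with σ-inj (trans same-colour (σ′≗ q))
... | refl = move-valid m q (row-offsets y y′ _ _ same-row)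

compatible-∘ : ∀ {y y′ σ σ′} (f : Pos → Pos) → Injective _≡_ _≡_ f →
               Compatible y σ y′ σ′ → Compatible y (f ∘ σ) y′ (f ∘ σ′)
compatible-∘ f f-inj compat p q eq = compat p q (f-inj eq)

compatible-≗ : ∀ {y y′ σ σ′ τ} → σ′ ≗ τ → Compatible y σ y′ σ′ → Compatible y σ y′ τ
compatible-≗ σ′≗τ compat p q eq = compat p q (trans eq (sym (σ′≗τ q)))

-- σ i sends the positions of column i to colours, which are the positions of the first column.
record Chain {k} (y : Fin (suc k) → Fin 3) (closing : Fin 3) (final : Pos → Pos) : Set where
  field
    σ         : Fin (suc k) → Pos → Pos
    start     : σ zero ≗ id
    injective : ∀ i → Injective _≡_ _≡_ (σ i)
    next      : ∀ i j → toℕ j ≡ suc (toℕ i) → Compatible (y i) (σ i) (y j) (σ j)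
    close     : Compatible (y (fromℕ k)) (σ (fromℕ k)) closing final

chain : ∀ {k} (y : Fin (suc k) → Fin 3) w (ms : All Move (stepsOf (y zero) (tabulate (y ∘ suc) ++ w ∷ []))) →
        Chain y w (product ms)
chain {zero} y w (m ∷ []) = record
  { σ = λ _ → id ; start = λ _ → refl ; injective = λ _ → id
  ; next = λ { zero zero () }
  ; close = compatible id m (λ _ → refl) }
chain {suc k} y w (m ∷ ms) = record
  { σ = σ ; start = λ _ → refl ; injective = injective ; next = next
  ; close = compatible-∘ ⟦ m ⟧ (move-injective m) (Chain.close rest) }
  where
  rest : Chain (y ∘ suc) w (product ms)
  rest = chain (y ∘ suc) w ms

  σ : Fin (suc (suc k)) → Pos → Pos
  σ zero    = id
  σ (suc i) = ⟦ m ⟧ ∘ Chain.σ rest i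

  injective : ∀ i → Injective _≡_ _≡_ (σ i)
  injective zero    eq = eq
  injective (suc i) eq = Chain.injective rest i (move-injective m eq)

  next : ∀ i j → toℕ j ≡ suc (toℕ i) → Compatible (y i) (σ i) (y j) (σ j)
  next zero    (suc zero) _  = compatible id m (λ p → cong ⟦ m ⟧ (Chain.start rest p))
  next (suc i) (suc j)    eq = compatible-∘ ⟦ m ⟧ (move-injective m) (Chain.next rest i j (cong pred eq))
  next zero    zero       ()
  next zero    (suc (suc _)) ()
  next (suc _) zero       ()

chain-≗ : ∀ {k} {y : Fin (suc k) → Fin 3} {w f g} → f ≗ g → Chain y w f → Chain y w g
chain-≗ f≗g columns = record
  { σ = σ ; start = start ; injective = injective ; next = next ; close = compatible-≗ f≗g close }
  where open Chain columns

toℕ≡0 : ∀ {k} (i : Fin (suc k)) → toℕ i ≡ 0 → i ≡ zero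
toℕ≡0 zero _ = refl

toℕ≡last : ∀ {k} (i : Fin (suc k)) → toℕ i ≡ k → i ≡ fromℕ k
toℕ≡last {k} i eq = toℕ-injective (trans eq (sym (toℕ-fromℕ k)))

colouring : ∀ {k} (W : List (Vtx (suc k))) → Unique W → (y : Fin (suc k) → Fin 3) →
            (∀ {i j} → (i , j) ∈ W → y i ≡ j) → Chain y (neg3 (y zero)) swap →
            Colourable 4 (replicateAll (H (suc k)) W)
colouring {k} W unique y on-word columns =
  replicateAll′-colourable 4 (H (suc k)) id id c c-proper d W unique replica twins
  where
  open Chain columns

  c : Vtx (suc k) → Fin 4
  c (i , j) = σ i (slot (y i) j)

  d : Vtx (suc k) → Fin 4
  d (i , j) = σ i twin

  distinct : ∀ {i j i′ j′} p p′ → HEdge (suc k) (i , j) (i′ , j′) →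
             rowAt (y i) p ≡ j → rowAt (y i′) p′ ≡ j′ → σ i p ≢ σ i′ p′
  distinct p p′ (inj₁ (refl , j≢j′)) row row′ eq =
    j≢j′ (trans (sym row) (trans (cong (rowAt _) (injective _ eq)) row′))
  distinct p p′ (inj₂ (inj₁ (succ , refl))) row row′ eq = next _ _ succ p p′ eq (trans row (sym row′))
  distinct {i} {j} {i′} p p′ (inj₂ (inj₂ (first , last , refl))) row row′ eq
    with toℕ≡0 i first | toℕ≡last i′ last
  ... | refl | refl =
    close p′ (swap p) (trans (sym eq) (trans (start p) (sym (swap-involutive p))))
          (trans row′ (sym (trans (rowAt-swap (y zero) p) (cong neg3 row))))

  twin-row : ∀ {i j} → (i , j) ∈ W → rowAt (y i) twin ≡ j
  twin-row w∈W = trans (rowAt-twin _) (on-word w∈W)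

  c-proper : ∀ u v → adj (H (suc k)) u v → c u ≢ c v
  c-proper (i , j) (i′ , j′) (inj₁ e) = distinct _ _ e (rowAt-slot (y i) j) (rowAt-slot (y i′) j′)
  c-proper (i , j) (i′ , j′) (inj₂ e) = distinct _ _ e (rowAt-slot (y i′) j′) (rowAt-slot (y i) j) ∘ sym

  replica : ∀ w → w ∈ W → ∀ v → v ≡ w ⊎ adj (H (suc k)) w v → d w ≢ c v
  replica (i , j) _    _         (inj₁ refl)     = slot≢twin (y i) j ∘ sym ∘ injective i
  replica (i , j) w∈W (i′ , j′) (inj₂ (inj₁ e)) = distinct _ _ e (twin-row w∈W) (rowAt-slot (y i′) j′)
  replica (i , j) w∈W (i′ , j′) (inj₂ (inj₂ e)) =
    distinct _ _ e (rowAt-slot (y i′) j′) (twin-row w∈W) ∘ sym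

  twins : ∀ u w → u ∈ W → w ∈ W → u ≢ w → adj (H (suc k)) u w → d u ≢ d w
  twins _ _ u∈W w∈W _ (inj₁ e) = distinct _ _ e (twin-row u∈W) (twin-row w∈W)
  twins _ _ u∈W w∈W _ (inj₂ e) = distinct _ _ e (twin-row w∈W) (twin-row u∈W) ∘ sym

-- The word of W and the exceptional words

isOdd-%2 : ∀ n → n % 2 ≡ (if isOdd n then 1 else 0)
isOdd-%2 zero          = refl
isOdd-%2 (suc zero)    = refl
isOdd-%2 (suc (suc n)) = trans (isOdd-%2 n) (cong (λ b → if b then 1 else 0) (sym (not-involutive (isOdd n))))

tabulate-length : ∀ {n} (f : Fin n → Fin 3) xs ys → tabulate f ≡ xs ++ ys → length xs + length ys ≡ n
tabulate-length f xs ys eq = trans (sym (length-++ xs)) (trans (cong length (sym eq)) (length-tabulate f))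

prefix-letters : ∀ {n} (f : Fin n → Fin 3) a c rest → tabulate f ≡ replicate a c ++ rest →
                 ∀ i → toℕ i < a → f i ≡ c
prefix-letters {suc n} f (suc a) c rest eq zero    _         = proj₁ (∷-injective eq)
prefix-letters {suc n} f (suc a) c rest eq (suc i) (s≤s i<a) =
  prefix-letters (f ∘ suc) a c rest (proj₂ (∷-injective eq)) i i<a

suffix-letters : ∀ {n} (f : Fin n → Fin 3) xs b d → tabulate f ≡ xs ++ replicate b d →
                 ∀ i → length xs ≤ toℕ i → f i ≡ d
suffix-letters {suc n} f []       (suc b) d eq zero    _        = proj₁ (∷-injective eq)
suffix-letters {suc n} f []       (suc b) d eq (suc i) _        =
  suffix-letters (f ∘ suc) [] b d (proj₂ (∷-injective eq)) i z≤n
suffix-letters {suc n} f (x ∷ xs) b d eq (suc i) (s≤s le) =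
  suffix-letters (f ∘ suc) xs b d (proj₂ (∷-injective eq)) i le

SharedColumn : ∀ {n} → List (Vtx n) → Set
SharedColumn {n} W =
  Σ (Fin n) λ i → Σ (Vtx n) λ u → Σ (Vtx n) λ v → u ∈ W × v ∈ W × u ≢ v × col u ≡ i × col v ≡ i

module Letters {n} (W : List (Vtx n)) (fill : Fin 3) where
  _≟ᵛ_ : (u v : Vtx n) → Dec (u ≡ v)
  _≟ᵛ_ = Product.≡-dec _≟_ _≟_

  open DecMembership _≟ᵛ_ using (_∈?_)

  letter : Fin n → Fin 3
  letter i with any? (λ j → (i , j) ∈? W)
  ... | yes (j , _) = j
  ... | no _        = fill

  letter-∈ : ∀ i {d} → letter i ≡ d → d ≢ fill → (i , d) ∈ W
  letter-∈ i refl d≢fill with any? (λ j → (i , j) ∈? W)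
  ... | yes (_ , ij∈W) = ij∈W
  ... | no _           = ⊥-elim (d≢fill refl)

  letter-of : ¬ SharedColumn W → ∀ {i j} → (i , j) ∈ W → letter i ≡ j
  letter-of unshared {i} {j} ij∈W with any? (λ j → (i , j) ∈? W)
  ... | no none = ⊥-elim (none (j , ij∈W))
  ... | yes (j′ , ij′∈W) with j′ ≟ j
  ...   | yes j′≡j = j′≡j
  ...   | no j′≢j  =
    ⊥-elim (unshared (i , (i , j′) , (i , j) , ij′∈W , ij∈W , j′≢j ∘ cong proj₂ , refl , refl))

countR0-bound : ∀ {k} (W : List (Vtx (suc k))) (j : Fin (suc k)) → (∀ i → i ≢ j → (i , r₀) ∈ W) →
                k ≤ countR0 W
countR0-bound {k} W j zeros = injective⇒≤ {f = position} position-injective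
  where
  R0 : List (Vtx (suc k))
  R0 = filter (λ v → row v ≟ zero) W

  member : ∀ i → (punchIn j i , r₀) ∈ R0
  member i = ∈-filter⁺ (λ v → row v ≟ zero) (zeros (punchIn j i) (punchInᵢ≢i j i)) refl

  position : Fin k → Fin (length R0)
  position i = index (member i)

  position-injective : ∀ {i i′} → position i ≡ position i′ → i ≡ i′
  position-injective {i} {i′} eq =
    punchIn-injective j i i′ (cong proj₁ (trans (lookup-index (member i))
                                         (trans (cong (lookup R0) eq) (sym (lookup-index (member i′))))))

walk : ∀ {G : Graph} {P : V G → Set} {v vs} → Linked (adj G) (v ∷ vs) → All P (v ∷ vs) →
       Walk G P (v ∷ vs)
walk [-]      (pv ∷ []) = one pv
walk (e ∷ es) (pv ∷ ps) = cons pv e (walk es ps)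

LongPath : ∀ {n} → List (Vtx n) → Set
LongPath {n} W = Σ (List (Vtx n)) λ p → PathIn (H n) (λ v → v ∈ W × row v ≢ zero) p × n ≤ length p

-- Rows c and -c meet only through a twisted edge, so the path runs through columns m, …, n - 1 in
-- row -c and then 0, …, m - 1 in row c; the t-th vertex is in column m + t reduced modulo n.
module TwoBlockPath {k} (W : List (Vtx (suc k))) (c : Fin 3) (c≢r₀ : c ≢ r₀) (m : ℕ) (m≤n : m ≤ suc k)
  (before : ∀ i → toℕ i < m → (i , c) ∈ W) (after : ∀ i → m ≤ toℕ i → (i , neg3 c) ∈ W) where

  n : ℕ
  n = suc k

  column : ℕ → Fin n
  column a with a <? n
  ... | yes a<n = fromℕ< a<n
  ... | no _    = zero

  toℕ-column : ∀ {a} → a < n → toℕ (column a) ≡ a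
  toℕ-column {a} a<n with a <? n
  ... | yes a<n′ = toℕ-fromℕ< a<n′
  ... | no a≮n   = ⊥-elim (a≮n a<n)

  vertex : ℕ → Vtx n
  vertex t with m + t <? n
  ... | yes _ = column (m + t) , neg3 c
  ... | no _  = column (m + t ∸ n) , c

  wrapped< : ∀ {t} → t < n → n ≤ m + t → m + t ∸ n < m
  wrapped< {t} t<n n≤ = subst (m + t ∸ n <_) (ℕ.m+n∸m≡n n m)
    (ℕ.∸-monoˡ-< {m + t} {n} {n + m} (subst (m + t <_) (ℕ.+-comm m n) (ℕ.+-monoʳ-< m t<n)) n≤)

  wrapped<n : ∀ {t} → t < n → n ≤ m + t → m + t ∸ n < n
  wrapped<n t<n n≤ = ℕ.<-≤-trans (wrapped< t<n n≤) m≤n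

  vertex-adjacent : ∀ {t} → suc t < n → adj (H n) (vertex t) (vertex (suc t))
  vertex-adjacent {t} t+1<n with m + t <? n | m + suc t <? n
  ... | yes a | yes b =
    inj₁ (inj₂ (inj₁ (trans (toℕ-column b) (trans (ℕ.+-suc m t) (cong suc (sym (toℕ-column a)))) , refl)))
  ... | yes a | no b  = inj₂ (inj₂ (inj₂ (first , last , refl)))
    where
    at-end : suc (m + t) ≡ n
    at-end = ℕ.≤-antisym a (ℕ.≮⇒≥ (b ∘ subst (_< n) (sym (ℕ.+-suc m t))))
    first : toℕ (column (m + suc t ∸ n)) ≡ 0
    first = trans (cong (λ a → toℕ (column (a ∸ n))) (trans (ℕ.+-suc m t) at-end))
                  (trans (cong (toℕ ∘ column) (ℕ.n∸n≡0 n)) (toℕ-column (s≤s z≤n)))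
    last : toℕ (column (m + t)) ≡ n ∸ 1
    last = trans (toℕ-column a) (cong (_∸ 1) at-end)
  ... | no a  | yes b = ⊥-elim (a (ℕ.<-trans (ℕ.+-monoʳ-< m (ℕ.n<1+n t)) b))
  ... | no a  | no b  = inj₁ (inj₂ (inj₁ (successor , refl)))
    where
    n≤ : n ≤ m + t
    n≤ = ℕ.≮⇒≥ a
    successor : toℕ (column (m + suc t ∸ n)) ≡ suc (toℕ (column (m + t ∸ n)))
    successor = trans (toℕ-column (wrapped<n t+1<n (subst (n ≤_) (sym (ℕ.+-suc m t)) (ℕ.m≤n⇒m≤1+n n≤))))
      (trans (cong (_∸ n) (ℕ.+-suc m t))
      (trans (ℕ.+-∸-assoc 1 n≤)
      (cong suc (sym (toℕ-column (wrapped<n (ℕ.<-trans (ℕ.n<1+n t) t+1<n) n≤))))))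

  vertex-injective : ∀ {i j} → i < j → j < n → vertex i ≢ vertex j
  vertex-injective {i} {j} i<j j<n eq with m + i <? n | m + j <? n
  ... | yes a | yes b = ℕ.<⇒≢ (ℕ.+-monoʳ-< m i<j)
        (trans (sym (toℕ-column a)) (trans (cong (toℕ ∘ proj₁) eq) (toℕ-column b)))
  ... | yes a | no b  = ℕ.<⇒≢ (ℕ.<-≤-trans (wrapped< j<n (ℕ.≮⇒≥ b)) (ℕ.m≤m+n m i))
        (trans (sym (toℕ-column (wrapped<n j<n (ℕ.≮⇒≥ b))))
               (trans (cong (toℕ ∘ proj₁) (sym eq)) (toℕ-column a)))
  ... | no a  | yes b = a (ℕ.<-trans (ℕ.+-monoʳ-< m i<j) b)
  ... | no a  | no b  = ℕ.<⇒≢ (ℕ.∸-monoˡ-< (ℕ.+-monoʳ-< m i<j) (ℕ.≮⇒≥ a))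
        (trans (sym (toℕ-column (wrapped<n (ℕ.<-trans i<j j<n) (ℕ.≮⇒≥ a))))
        (trans (cong (toℕ ∘ proj₁) eq) (toℕ-column (wrapped<n j<n (ℕ.≮⇒≥ b)))))

  vertex-in : ∀ {t} → t < n → vertex t ∈ W × row (vertex t) ≢ zero
  vertex-in {t} t<n with m + t <? n
  ... | yes a = after _ (subst (m ≤_) (sym (toℕ-column a)) (ℕ.m≤m+n m t)) , neg3-nonzero c c≢r₀
  ... | no a  =
    before _ (subst (_< m) (sym (toℕ-column (wrapped<n t<n (ℕ.≮⇒≥ a)))) (wrapped< t<n (ℕ.≮⇒≥ a)))
    , c≢r₀

  path : LongPath W
  path = applyUpTo vertex n
       , (walk (Linked.applyUpTo⁺₁ vertex n vertex-adjacent) (All.tabulate in-path)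
       , Unique.applyUpTo⁺₁ vertex n vertex-injective)
       , ℕ.≤-reflexive (sym (length-applyUpTo vertex n))
    where
    in-path : ∀ {v} → v ∈ applyUpTo vertex n → v ∈ W × row v ≢ zero
    in-path v∈ with ∈-applyUpTo⁻ vertex v∈
    ... | t , t<n , refl = vertex-in t<n

-- The dummy letter is 1 for odd n (so every zero letter is a vertex of W ∩ R₀) and 0 for even n
-- (so a word without zeros has all its vertices in W ∖ R₀).
filler : ℕ → Fin 3
filler n = if isOdd n then r₁ else r₀

wordOf : ∀ {n} → List (Vtx n) → Fin n → Fin 3
wordOf {n} W = Letters.letter W (filler n)

nearly-zero-count : ∀ {k} (W : List (Vtx (suc k))) a v b →
                    tabulate (wordOf W) ≡ replicate a r₀ ++ v ∷ replicate b r₀ → isOdd (suc k) ≡ true →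
                    k ≤ countR0 W
nearly-zero-count {k} W a v b shape odd = countR0-bound W (fromℕ< a<n) zeros
  where
  open Letters W (filler (suc k))

  a<n : a < suc k
  a<n = ℕ.<-≤-trans (ℕ.m<m+n a (s≤s z≤n))
          (ℕ.≤-reflexive (trans (cong (_+ length (v ∷ replicate b r₀)) (sym (length-replicate a)))
                                (tabulate-length letter (replicate a r₀) _ shape)))

  zero-letter : ∀ i → toℕ i ≢ a → letter i ≡ r₀
  zero-letter i i≢a with ℕ.<-cmp (toℕ i) a
  ... | tri< i<a _ _ = prefix-letters letter a r₀ _ shape i i<a
  ... | tri≈ _ i≡a _ = ⊥-elim (i≢a i≡a)
  ... | tri> _ _ a<i =
    suffix-letters letter (replicate a r₀ ++ v ∷ []) b r₀
      (trans shape (sym (++-assoc (replicate a r₀) (v ∷ []) _)))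
      i (subst (_≤ toℕ i) (sym (trans (length-++ (replicate a r₀)) (trans (cong (_+ 1) (length-replicate a))
                                                                           (ℕ.+-comm a 1)))) a<i)

  zeros : ∀ i → i ≢ fromℕ< a<n → (i , r₀) ∈ W
  zeros i i≢j =
    letter-∈ i (zero-letter i λ i≡a → i≢j (toℕ-injective (trans i≡a (sym (toℕ-fromℕ< a<n)))))
               (subst (r₀ ≢_) (cong (λ b → if b then r₁ else r₀) (sym odd)) λ ())

two-blocks-path : ∀ {k} (W : List (Vtx (suc k))) a b c → c ≢ r₀ →
                  tabulate (wordOf W) ≡ replicate (suc a) c ++ replicate b (neg3 c) → isOdd (suc k) ≡ false →
                  LongPath W
two-blocks-path {k} W a b c c≢r₀ shape even = TwoBlockPath.path W c c≢r₀ (suc a) m≤n before after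
  where
  open Letters W (filler (suc k))

  m≤n : suc a ≤ suc k
  m≤n = ℕ.≤-trans (ℕ.m≤m+n (suc a) _)
          (ℕ.≤-reflexive (trans (cong (_+ length (replicate b (neg3 c))) (sym (length-replicate (suc a))))
                                (tabulate-length letter (replicate (suc a) c) _ shape)))

  nonzero-∈ : ∀ i {d} → letter i ≡ d → d ≢ r₀ → (i , d) ∈ W
  nonzero-∈ i is-d d≢r₀ =
    letter-∈ i is-d (subst (_ ≢_) (cong (λ b → if b then r₁ else r₀) (sym even)) d≢r₀)

  before : ∀ i → toℕ i < suc a → (i , c) ∈ W
  before i i<m = nonzero-∈ i (prefix-letters letter (suc a) c _ shape i i<m) c≢r₀

  after : ∀ i → suc a ≤ toℕ i → (i , neg3 c) ∈ W
  after i m≤i = nonzero-∈ i (suffix-letters letter (replicate (suc a) c) b (neg3 c) shape i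
                                            (subst (_≤ toℕ i) (sym (length-replicate (suc a))) m≤i))
                            (neg3-nonzero c c≢r₀)

exceptional-word : ∀ {k} (W : List (Vtx (suc k))) → Exceptional (tabulate (wordOf W)) →
                   (k ≤ countR0 W × suc k % 2 ≡ 1) ⊎ (LongPath W × suc k % 2 ≡ 0)
exceptional-word {k} W (nearly-zero a v b shape odd) =
  inj₁ (nearly-zero-count W a v b shape odd-n ,
        trans (isOdd-%2 (suc k)) (cong (λ b → if b then 1 else 0) odd-n))
  where
  odd-n : isOdd (suc k) ≡ true
  odd-n = trans (cong isOdd (sym (length-tabulate (wordOf W)))) odd
exceptional-word {k} W (two-blocks a b c c≢r₀ shape even) =
  inj₂ (two-blocks-path W a b c c≢r₀ shape even-n ,
        trans (isOdd-%2 (suc k)) (cong (λ b → if b then 1 else 0) even-n))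
  where
  even-n : isOdd (suc k) ≡ false
  even-n = trans (cong isOdd (sym (length-tabulate (wordOf W)))) even

proposition2p8 : (n : ℕ) → 4 ≤ n → (W : List (Vtx n)) → Unique W
  → ¬ (Σ (Fin n) λ i → Σ (Vtx n) λ u → Σ (Vtx n) λ v → u ∈ W × v ∈ W × u ≢ v × col u ≡ i × col v ≡ i)
  → ¬ (n ∸ 1 ≤ countR0 W × n % 2 ≡ 1)
  → ¬ ((Σ (List (Vtx n)) λ p → PathIn (H n) (λ v → v ∈ W × row v ≢ zero) p × n ≤ length p) × n % 2 ≡ 0)
  → Colourable 4 (replicateAll (H n) W)
proposition2p8 (suc k) (s≤s 3≤k) W unique unshared ¬few-nonzero ¬long-path
  with word-realises (wordOf W zero) (tabulate (wordOf W ∘ suc))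
                     (subst (3 ≤_) (sym (length-tabulate (wordOf W ∘ suc))) 3≤k)
... | inj₁ (moves , moves≗swap) =
  colouring W unique (wordOf W) (Letters.letter-of W _ unshared) (chain-≗ moves≗swap (chain (wordOf W) _ moves))
... | inj₂ exceptional with exceptional-word W exceptional
...   | inj₁ few-nonzero = ⊥-elim (¬few-nonzero few-nonzero)
...   | inj₂ long-path   = ⊥-elim (¬long-path long-path)
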